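{- Let $G$ be a graph with $\underline{f}(G)\ge 3$. Then $\mathrm{MObs}(G;i)\ge 3$ for all $i\in\{1,\dots,\gamma_P(G)\}$.
   Context: Graphs are finite and simple with at least one vertex. Power domination: from $S\subseteq V(G)$, first $N[S]$ is observed; then repeatedly, while an observed vertex has exactly one unobserved neighbor, that neighbor becomes observed; the final set is $\mathrm{Obs}(G;S)$. $\gamma_P(G)$ is the least $|S|$ with $\mathrm{Obs}(G;S)=V(G)$. $\mathrm{maxObs}(G;k):=\max_{|S|=k}|\mathrm{Obs}(G;S)|$ and $\mathrm{MObs}(G;k):=\mathrm{maxObs}(G;k)-\mathrm{maxObs}(G;k-1)$. A fort is a nonempty $F\subseteq V(G)$ such that no vertex of $V(G)\setminus F$ has exactly one neighbor in $F$; $\underline{f}(G)$ is the minimum size of a fort. -}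

module Defs where

open import Data.Bool using (Bool; true; false; _∧_; _∨_; not; if_then_else_)
open import Data.Nat using (ℕ; zero; suc; _+_; _⊔_; _≡ᵇ_)
open import Data.Fin using (Fin; zero; suc)
open import Data.Fin.Subset using (Subset; ∣_∣; ⊤; ⊥)
open import Data.Vec using (Vec; []; _∷_; lookup; tabulate)
open import Data.List using (List; []; _∷_; map; filterᵇ; foldr; _++_)
open import Function using (_∘_)
open import Relation.Binary.PropositionalEquality using (_≡_; _≢_)

record Graph (n : ℕ) : Set where
  field
    adj    : Fin n → Fin n → Bool
    sym    : ∀ u v → adj u v ≡ adj v u
    irrefl : ∀ v → adj v v ≡ false
open Graph public

anyFin : ∀ {n} → (Fin n → Bool) → Bool
anyFin {zero}  f = false
anyFin {suc n} f = f zero ∨ anyFin (f ∘ suc)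

countFin : ∀ {n} → (Fin n → Bool) → ℕ
countFin {zero}  f = 0
countFin {suc n} f = (if f zero then 1 else 0) + countFin (f ∘ suc)

closedNbhd : ∀ {n} → Graph n → Subset n → Subset n
closedNbhd G S = tabulate λ v → lookup S v ∨ anyFin (λ u → lookup S u ∧ adj G u v)

unobsNbrs : ∀ {n} → Graph n → Subset n → Fin n → ℕ
unobsNbrs G O u = countFin λ w → adj G u w ∧ not (lookup O w)

-- one round of the propagation rule (applied to all observed vertices
-- simultaneously): w becomes observed if some observed neighbour u of w
-- has exactly one unobserved neighbour (which is then necessarily w).
forceStep : ∀ {n} → Graph n → Subset n → Subset n
forceStep G O = tabulate λ w →
  lookup O w ∨ anyFin (λ u → lookup O u ∧ adj G u w ∧ (unobsNbrs G O u ≡ᵇ 1))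

iter : ∀ {A : Set} → ℕ → (A → A) → A → A
iter zero    f x = x
iter (suc k) f x = iter k f (f x)

-- Obs(G;S): start from N[S] and propagate; n rounds suffice for the
-- process to stabilise (each non-stable round adds a vertex).
Obs : ∀ {n} → Graph n → Subset n → Subset n
Obs {n} G S = iter n (forceStep G) (closedNbhd G S)

allSubsets : (n : ℕ) → List (Subset n)
allSubsets zero    = [] ∷ []
allSubsets (suc n) = map (true ∷_) (allSubsets n) ++ map (false ∷_) (allSubsets n)

maxObs : ∀ {n} → Graph n → ℕ → ℕ
maxObs {n} G k =
  foldr _⊔_ 0 (map (λ S → ∣ Obs G S ∣) (filterᵇ (λ S → ∣ S ∣ ≡ᵇ k) (allSubsets n)))

IsFort : ∀ {n} → Graph n → Subset n → Set
IsFort G F =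
  (F ≢ ⊥) × (∀ v → lookup F v ≡ false → countFin (λ u → adj G v u ∧ lookup F u) ≢ 1)
  where open import Data.Product using (_×_)

IsPDS : ∀ {n} → Graph n → Subset n → Set
IsPDS G S = Obs G S ≡ ⊤

IsPowerDomNumber : ∀ {n} → Graph n → ℕ → Set
IsPowerDomNumber G γ =
  (Σ _ λ S → ∣ S ∣ ≡ γ × IsPDS G S) × (∀ S → IsPDS G S → γ ≤ ∣ S ∣)
  where open import Data.Product using (_×_; Σ)
        open import Data.Nat using (_≤_)

module Submission where

open import Defs hiding (sym)
open import Data.Bool using (Bool; true; false; _∧_; _∨_; not; if_then_else_) renaming (_≟_ to _≟ᵇ_)
open import Data.Bool.Properties using (∧-conicalˡ; ∧-conicalʳ; ∧-identityʳ; ∧-zeroʳ; ∨-zeroʳ; T-≡)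
open import Data.Nat using (ℕ; zero; suc; pred; _+_; _≤_; _<_; _≡ᵇ_; _⊔_; _≤?_; z≤n; s≤s; s≤s⁻¹)
open import Data.Nat.Properties
  using ( +-comm; +-suc; +-monoˡ-≤; +-monoʳ-≤; m≤m+n; m≤n+m; n≤1+n; ≤-reflexive; ≤-trans; ≤-antisym
        ; n≮n; ≰⇒>; n≢0⇒n>0; ≡ᵇ⇒≡; ≡⇒≡ᵇ; ⊔-sel; m≤n⇒m≤n⊔o; m≤n⇒m≤o⊔n; module ≤-Reasoning)
open import Data.Fin using (Fin; zero; suc; _≟_)
open import Data.Fin.Properties using (any?)
open import Data.Fin.Subset using (Subset; ∣_∣; ⊤; ⊥; _─_)
open import Data.Fin.Subset.Properties using (∣p∣≤n; ∣p∣≡n⇒p≡⊤; ∣⊥∣≡0)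
open import Data.Vec using ([]; _∷_; lookup; _[_]≔_)
open import Data.Vec.Properties
  using (lookup∘tabulate; lookup∘update; lookup∘update′; lookup-replicate; []≔-lookup)
open import Data.List using (List; map; filterᵇ)
open import Data.List.Properties using (foldr-preservesᵒ)
open import Data.List.Membership.Propositional using (_∈_)
open import Data.List.Membership.Propositional.Properties
  using (∈-map⁺; ∈-map⁻; ∈-++⁺ˡ; ∈-++⁺ʳ; ∈-filter⁺; ∈-filter⁻; foldr-selective)
open import Data.List.Relation.Unary.Any as Any using (here)
open import Data.Product using (∃; _×_; _,_; proj₂)
open import Data.Sum using (_⊎_; inj₁; inj₂; [_,_])
open import Function using (_∘_; Equivalence)
open import Relation.Binary.PropositionalEquality
  using (_≡_; _≢_; _≗_; refl; sym; trans; cong; cong₂; subst; subst₂; module ≡-Reasoning)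
open import Relation.Nullary using (¬_; yes; no; contradiction)
open import Relation.Nullary.Decidable using (_×-dec_; T?)

-- Take S of size i - 1 with ∣Obs(G; S)∣ = maxObs(G; i - 1). As i - 1 < γ_P(G), the set
-- O = Obs(G; S) is a proper subset of V, and it is closed: no vertex of O has exactly one
-- neighbour outside O. If some closed neighbourhood N[w] meets V ∖ O in three vertices, adding
-- w to S observes them at once. Otherwise pick x ∉ O and let O' = Obs(G; S ∪ {x}); then O' ∖ O
-- is a fort, hence has at least three vertices. Indeed, a vertex of O with exactly one
-- neighbour in O' ∖ O has exactly two neighbours outside O (not one, by closedness, and at most
-- two), so exactly one outside O'; and a vertex outside O' adjacent to d ∈ O' ∖ O is the only
-- neighbour of d outside O', as d has at most one neighbour outside O. Both contradict the
-- closedness of O'.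

∨-elim : ∀ {a b} → a ∨ b ≡ true → a ≡ true ⊎ b ≡ true
∨-elim {true}  _  = inj₁ refl
∨-elim {false} ab = inj₂ ab

∨-introʳ : ∀ a {b} → b ≡ true → a ∨ b ≡ true
∨-introʳ a refl = ∨-zeroʳ a

not-true : ∀ {b} → not b ≡ true → b ≡ false
not-true {false} _ = refl

≡ᵇ-true⇒≡ : ∀ {m n} → (m ≡ᵇ n) ≡ true → m ≡ n
≡ᵇ-true⇒≡ {m} {n} e = ≡ᵇ⇒≡ m n (Equivalence.from T-≡ e)

≡⇒≡ᵇ-true : ∀ {m n} → m ≡ n → (m ≡ᵇ n) ≡ true
≡⇒≡ᵇ-true {m} {n} e = Equivalence.to T-≡ (≡⇒≡ᵇ m n e)

infix 4 _⊑_
_⊑_ : ∀ {n} → (Fin n → Bool) → (Fin n → Bool) → Set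
f ⊑ g = ∀ x → f x ≡ true → g x ≡ true

∧-not-antitone : ∀ {n} {f g : Fin n → Bool} (h : Fin n → Bool) → f ⊑ g →
                 (λ x → h x ∧ not (g x)) ⊑ (λ x → h x ∧ not (f x))
∧-not-antitone {f = f} {g} h f⊑g x e with f x in fx | g x in gx
... | true  | true  = e
... | true  | false = contradiction (trans (sym (f⊑g x fx)) gx) λ ()
... | false | _     = trans (∧-identityʳ (h x)) (∧-conicalˡ _ _ e)

anyFin-witness : ∀ {n} (f : Fin n → Bool) → anyFin f ≡ true → ∃ λ x → f x ≡ true
anyFin-witness {suc n} f any with f zero in fz
... | true  = zero , fz
... | false = let x , fx = anyFin-witness (f ∘ suc) any in suc x , fx

anyFin-intro : ∀ {n} (f : Fin n → Bool) x → f x ≡ true → anyFin f ≡ true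
anyFin-intro f zero    fx rewrite fx = refl
anyFin-intro f (suc x) fx with f zero
... | true  = refl
... | false = anyFin-intro (f ∘ suc) x fx

countFin-cong : ∀ {n} {f g : Fin n → Bool} → f ≗ g → countFin f ≡ countFin g
countFin-cong {zero}  f≗g = refl
countFin-cong {suc n} f≗g =
  cong₂ _+_ (cong (λ b → if b then 1 else 0) (f≗g zero)) (countFin-cong (f≗g ∘ suc))

countFin-split : ∀ {n} (f g : Fin n → Bool) →
                 countFin f ≡ countFin (λ x → f x ∧ g x) + countFin (λ x → f x ∧ not (g x))
countFin-split {zero}  f g = refl
countFin-split {suc n} f g with f zero | g zero
... | true  | true  = cong suc (countFin-split (f ∘ suc) (g ∘ suc))
... | true  | false = trans (cong suc (countFin-split (f ∘ suc) (g ∘ suc))) (sym (+-suc _ _))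
... | false | _     = countFin-split (f ∘ suc) (g ∘ suc)

countFin-⊑-split : ∀ {n} {f g : Fin n → Bool} → f ⊑ g →
                   countFin g ≡ countFin f + countFin (λ x → g x ∧ not (f x))
countFin-⊑-split {f = f} {g} f⊑g =
  trans (countFin-split g f) (cong (_+ countFin (λ x → g x ∧ not (f x))) (countFin-cong g∧f≗f))
  where
  g∧f≗f : ∀ x → g x ∧ f x ≡ f x
  g∧f≗f x with f x in fx
  ... | true  = cong (_∧ true) (f⊑g x fx)
  ... | false = ∧-zeroʳ (g x)

countFin-pos : ∀ {n} (f : Fin n → Bool) x → f x ≡ true → 1 ≤ countFin f
countFin-pos f zero    fx rewrite fx = s≤s z≤n
countFin-pos f (suc x) fx = ≤-trans (countFin-pos (f ∘ suc) x fx) (m≤n+m _ _)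

countFin-witness : ∀ {n} (f : Fin n → Bool) → 1 ≤ countFin f → ∃ λ x → f x ≡ true
countFin-witness {suc n} f 1≤ with f zero in fz
... | true  = zero , fz
... | false = let x , fx = countFin-witness (f ∘ suc) 1≤ in suc x , fx

countFin-mono : ∀ {n} {f g : Fin n → Bool} → f ⊑ g → countFin f ≤ countFin g
countFin-mono f⊑g = ≤-trans (m≤m+n _ _) (≤-reflexive (sym (countFin-⊑-split f⊑g)))

countFin-strict : ∀ {n} {f g : Fin n → Bool} x → f ⊑ g → g x ≡ true → f x ≡ false →
                  1 + countFin f ≤ countFin g
countFin-strict {f = f} {g} x f⊑g gx fx = begin
  1 + countFin f                                ≡⟨ +-comm 1 (countFin f) ⟩
  countFin f + 1                                ≤⟨ +-monoʳ-≤ (countFin f) g∖f-nonempty ⟩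
  countFin f + countFin (λ y → g y ∧ not (f y)) ≡⟨ sym (countFin-⊑-split f⊑g) ⟩
  countFin g                                    ∎
  where
  open ≤-Reasoning
  g∖f-nonempty = countFin-pos _ x (cong₂ _∧_ gx (cong not fx))

∣p∣≡countFin : ∀ {n} (p : Subset n) → ∣ p ∣ ≡ countFin (lookup p)
∣p∣≡countFin []          = refl
∣p∣≡countFin (true  ∷ p) = cong suc (∣p∣≡countFin p)
∣p∣≡countFin (false ∷ p) = ∣p∣≡countFin p

lookup-─ : ∀ {n} (p q : Subset n) x → lookup (p ─ q) x ≡ lookup p x ∧ not (lookup q x)
lookup-─ (a ∷ p) (true  ∷ q) zero    = sym (∧-zeroʳ a)
lookup-─ (a ∷ p) (false ∷ q) zero    = sym (∧-identityʳ a)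
lookup-─ (_ ∷ p) (_     ∷ q) (suc x) = lookup-─ p q x

∣q∣≡∣p∣+∣q─p∣ : ∀ {n} (p q : Subset n) → lookup p ⊑ lookup q → ∣ q ∣ ≡ ∣ p ∣ + ∣ q ─ p ∣
∣q∣≡∣p∣+∣q─p∣ p q p⊑q = begin
  ∣ q ∣                                 ≡⟨ ∣p∣≡countFin q ⟩
  countFin (lookup q)                   ≡⟨ countFin-⊑-split p⊑q ⟩
  countFin (lookup p) + countFin (λ x → lookup q x ∧ not (lookup p x))
    ≡⟨ cong₂ _+_ (sym (∣p∣≡countFin p)) (countFin-cong (sym ∘ lookup-─ q p)) ⟩
  ∣ p ∣ + countFin (lookup (q ─ p))     ≡⟨ cong (∣ p ∣ +_) (sym (∣p∣≡countFin (q ─ p))) ⟩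
  ∣ p ∣ + ∣ q ─ p ∣                     ∎
  where open ≡-Reasoning

⊑[]≔true : ∀ {n} (S : Subset n) w → lookup S ⊑ lookup (S [ w ]≔ true)
⊑[]≔true S w x sx with x ≟ w
... | yes refl = lookup∘update w S true
... | no  x≢w  = trans (lookup∘update′ x≢w S true) sx

∈⇒[]≔true≡ : ∀ {n} (S : Subset n) {w} → lookup S w ≡ true → S [ w ]≔ true ≡ S
∈⇒[]≔true≡ S {w} sw = subst (λ b → S [ w ]≔ b ≡ S) sw ([]≔-lookup S w)

∣[]≔true∣ : ∀ {n} (S : Subset n) {w} → lookup S w ≡ false → ∣ S [ w ]≔ true ∣ ≡ suc ∣ S ∣
∣[]≔true∣ (false ∷ S) {zero}  refl = refl
∣[]≔true∣ (true  ∷ S) {suc w} sw   = cong suc (∣[]≔true∣ S sw)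
∣[]≔true∣ (false ∷ S) {suc w} sw   = ∣[]≔true∣ S sw

p≢⊤⇒∃-outside : ∀ {n} {p : Subset n} → p ≢ ⊤ → ∃ λ x → lookup p x ≡ false
p≢⊤⇒∃-outside {p = []}        p≢⊤ = contradiction refl p≢⊤
p≢⊤⇒∃-outside {p = false ∷ p} _   = zero , refl
p≢⊤⇒∃-outside {p = true  ∷ p} p≢⊤ =
  let x , px = p≢⊤⇒∃-outside (p≢⊤ ∘ cong (true ∷_)) in suc x , px

subsetOfSize : ∀ {n k} → k ≤ n → ∃ λ (p : Subset n) → ∣ p ∣ ≡ k
subsetOfSize {n}     {zero}  _         = ⊥ , ∣⊥∣≡0 n
subsetOfSize {suc n} {suc k} (s≤s k≤n) =
  let p , ∣p∣≡k = subsetOfSize k≤n in true ∷ p , cong suc ∣p∣≡k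

allSubsets-complete : ∀ {n} (p : Subset n) → p ∈ allSubsets n
allSubsets-complete []                  = here refl
allSubsets-complete {suc n} (true  ∷ p) = ∈-++⁺ˡ (∈-map⁺ (true ∷_) (allSubsets-complete p))
allSubsets-complete {suc n} (false ∷ p) =
  ∈-++⁺ʳ (map (true ∷_) (allSubsets n)) (∈-map⁺ (false ∷_) (allSubsets-complete p))

Inflationary : ∀ {n} → (Subset n → Subset n) → Set
Inflationary f = ∀ p → lookup p ⊑ lookup (f p)

Monotone : ∀ {n} → (Subset n → Subset n) → Set
Monotone f = ∀ p q → lookup p ⊑ lookup q → lookup (f p) ⊑ lookup (f q)

Stable : ∀ {n} → (Subset n → Subset n) → Subset n → Set
Stable f p = lookup (f p) ⊑ lookup p

module _ {n} {f : Subset n → Subset n} where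

  iter-inflationary : Inflationary f → ∀ k p → lookup p ⊑ lookup (iter k f p)
  iter-inflationary infl zero    p x px = px
  iter-inflationary infl (suc k) p x px = iter-inflationary infl k (f p) x (infl p x px)

  iter-monotone : Monotone f → ∀ k → Monotone (iter k f)
  iter-monotone mono zero    p q p⊑q = p⊑q
  iter-monotone mono (suc k) p q p⊑q = iter-monotone mono k (f p) (f q) (mono p q p⊑q)

  iter-suc : ∀ k p → iter (suc k) f p ≡ f (iter k f p)
  iter-suc zero    p = refl
  iter-suc (suc k) p = iter-suc k (f p)

  stable-or-grows : Inflationary f → ∀ p → Stable f p ⊎ ∣ p ∣ < ∣ f p ∣
  stable-or-grows infl p with any? (λ x → (lookup (f p) x ≟ᵇ true) ×-dec (lookup p x ≟ᵇ false))
  ... | yes (x , fpx , px) = inj₂ (subst₂ _<_ (sym (∣p∣≡countFin p)) (sym (∣p∣≡countFin (f p)))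
                                     (countFin-strict x (infl p) fpx px))
  ... | no no-new = inj₁ stable
    where
    stable : Stable f p
    stable x fpx with lookup p x in px
    ... | true  = refl
    ... | false = contradiction (x , fpx , px) no-new

  iter-stable-or-large : Inflationary f → Monotone f → ∀ k p →
                         Stable f (iter k f p) ⊎ k ≤ ∣ iter k f p ∣
  iter-stable-or-large infl mono zero    p = inj₂ z≤n
  iter-stable-or-large infl mono (suc k) p rewrite iter-suc k p
    with iter-stable-or-large infl mono k p
  ... | inj₁ stable = inj₁ (mono _ _ stable)
  ... | inj₂ large with stable-or-grows infl (iter k f p)
  ...   | inj₁ stable = inj₁ (mono _ _ stable)
  ...   | inj₂ grows  = inj₂ (≤-trans (s≤s large) grows)

  iter-stable : Inflationary f → Monotone f → ∀ p → Stable f (iter n f p)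
  iter-stable infl mono p with iter-stable-or-large infl mono n p
  ... | inj₁ stable = stable
  ... | inj₂ large  = λ x _ → trans (cong (λ q → lookup q x) full) (lookup-replicate x true)
    where
    full : iter n f p ≡ ⊤
    full = ∣p∣≡n⇒p≡⊤ (≤-antisym (∣p∣≤n (iter n f p)) large)

module _ {n} (G : Graph n) where

  Closed : Subset n → Set
  Closed O = ∀ u → lookup O u ≡ true → unobsNbrs G O u ≢ 1

  unobsNbrs-antitone : ∀ O O' u → lookup O ⊑ lookup O' → unobsNbrs G O' u ≤ unobsNbrs G O u
  unobsNbrs-antitone O O' u O⊑O' = countFin-mono (∧-not-antitone (adj G u) O⊑O')

  unobsNbrs-pos : ∀ O {u w} → adj G u w ≡ true → lookup O w ≡ false → 1 ≤ unobsNbrs G O u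
  unobsNbrs-pos O {w = w} uw ow = countFin-pos _ w (cong₂ _∧_ uw (cong not ow))

  unobsNbrs-split : ∀ O O' u → lookup O ⊑ lookup O' →
    unobsNbrs G O u ≡ unobsNbrs G O' u + countFin (λ w → adj G u w ∧ lookup (O' ─ O) w)
  unobsNbrs-split O O' u O⊑O' = trans (countFin-⊑-split (∧-not-antitone (adj G u) O⊑O'))
                                      (cong (unobsNbrs G O' u +_) (countFin-cong newly))
    where
    newly : ∀ w → (adj G u w ∧ not (lookup O w)) ∧ not (adj G u w ∧ not (lookup O' w))
                  ≡ adj G u w ∧ lookup (O' ─ O) w
    newly w rewrite lookup-─ O' O w with adj G u w | lookup O w in ow | lookup O' w in ow'
    ... | false | _     | _     = refl
    ... | true  | true  | true  = refl
    ... | true  | true  | false = contradiction (trans (sym (O⊑O' w ow)) ow') λ ()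
    ... | true  | false | true  = refl
    ... | true  | false | false = refl

  unobsClosedNbrs : Subset n → Fin n → ℕ
  unobsClosedNbrs O w = (if lookup O w then 0 else 1) + unobsNbrs G O w

  unobsClosedNbrs-observed : ∀ O {w} → lookup O w ≡ true → unobsClosedNbrs O w ≡ unobsNbrs G O w
  unobsClosedNbrs-observed O ow rewrite ow = refl

  unobsClosedNbrs-unobserved : ∀ O {w} → lookup O w ≡ false →
                               unobsClosedNbrs O w ≡ 1 + unobsNbrs G O w
  unobsClosedNbrs-unobserved O ow rewrite ow = refl

  forces : Subset n → Fin n → Fin n → Bool
  forces O u w = lookup O u ∧ adj G u w ∧ (unobsNbrs G O u ≡ᵇ 1)

  forces-intro : ∀ O {u w} → lookup O u ≡ true → adj G u w ≡ true → unobsNbrs G O u ≡ 1 →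
                 forces O u w ≡ true
  forces-intro O ou uw one = cong₂ _∧_ ou (cong₂ _∧_ uw (≡⇒≡ᵇ-true one))

  forces-elim : ∀ O u w → forces O u w ≡ true →
                lookup O u ≡ true × adj G u w ≡ true × unobsNbrs G O u ≡ 1
  forces-elim O u w e = ∧-conicalˡ (lookup O u) _ e
                      , ∧-conicalˡ (adj G u w) _ rest
                      , ≡ᵇ-true⇒≡ (∧-conicalʳ (adj G u w) _ rest)
    where
    rest = ∧-conicalʳ (lookup O u) _ e

  forces-monotone : ∀ O O' u {w} → lookup O ⊑ lookup O' → lookup O' w ≡ false →
                    forces O u w ≡ true → forces O' u w ≡ true
  forces-monotone O O' u {w} O⊑O' ow' e with forces-elim O u w e
  ... | ou , uw , one = forces-intro O' (O⊑O' u ou) uw (≤-antisym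
    (≤-trans (unobsNbrs-antitone O O' u O⊑O') (≤-reflexive one)) (unobsNbrs-pos O' uw ow'))

  lookup-forceStep : ∀ O w → lookup (forceStep G O) w ≡ (lookup O w ∨ anyFin (λ u → forces O u w))
  lookup-forceStep O w = lookup∘tabulate _ w

  forceStep-inflationary : Inflationary (forceStep G)
  forceStep-inflationary O w ow rewrite lookup-forceStep O w | ow = refl

  forceStep-monotone : Monotone (forceStep G)
  forceStep-monotone O O' O⊑O' w w∈ rewrite lookup-forceStep O' w with lookup O' w in ow'
  ... | true  = refl
  ... | false with ∨-elim (trans (sym (lookup-forceStep O w)) w∈)
  ...   | inj₁ ow  = contradiction (trans (sym (O⊑O' w ow)) ow') λ ()
  ...   | inj₂ any = let u , uw = anyFin-witness (λ u → forces O u w) any in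
                     anyFin-intro (λ u → forces O' u w) u (forces-monotone O O' u O⊑O' ow' uw)

  stable⇒closed : ∀ O → Stable (forceStep G) O → Closed O
  stable⇒closed O stable u ou one with countFin-witness _ (≤-reflexive (sym one))
  ... | w , uw∧w∉O = contradiction (trans (sym (stable w w∈)) w∉O) λ ()
    where
    w∉O : lookup O w ≡ false
    w∉O = not-true (∧-conicalʳ (adj G u w) _ uw∧w∉O)
    w∈ : lookup (forceStep G O) w ≡ true
    w∈ = trans (lookup-forceStep O w) (∨-introʳ (lookup O w)
           (anyFin-intro (λ u → forces O u w) u (forces-intro O ou (∧-conicalˡ _ _ uw∧w∉O) one)))

  lookup-closedNbhd : ∀ S v →
    lookup (closedNbhd G S) v ≡ (lookup S v ∨ anyFin (λ u → lookup S u ∧ adj G u v))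
  lookup-closedNbhd S v = lookup∘tabulate _ v

  ⊑closedNbhd : ∀ S → lookup S ⊑ lookup (closedNbhd G S)
  ⊑closedNbhd S v sv rewrite lookup-closedNbhd S v | sv = refl

  nbr∈closedNbhd : ∀ S {u v} → lookup S u ≡ true → adj G u v ≡ true →
                   lookup (closedNbhd G S) v ≡ true
  nbr∈closedNbhd S {u} {v} su uv = trans (lookup-closedNbhd S v)
    (∨-introʳ (lookup S v) (anyFin-intro (λ u → lookup S u ∧ adj G u v) u (cong₂ _∧_ su uv)))

  closedNbhd-monotone : Monotone (closedNbhd G)
  closedNbhd-monotone S T S⊑T v v∈ with ∨-elim (trans (sym (lookup-closedNbhd S v)) v∈)
  ... | inj₁ sv  = ⊑closedNbhd T v (S⊑T v sv)
  ... | inj₂ any = let u , su∧uv = anyFin-witness (λ u → lookup S u ∧ adj G u v) any in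
                   nbr∈closedNbhd T (S⊑T u (∧-conicalˡ _ _ su∧uv)) (∧-conicalʳ (lookup S u) _ su∧uv)

  Obs-monotone : Monotone (Obs G)
  Obs-monotone S T S⊑T = iter-monotone forceStep-monotone n
    (closedNbhd G S) (closedNbhd G T) (closedNbhd-monotone S T S⊑T)

  closedNbhd⊑Obs : ∀ S → lookup (closedNbhd G S) ⊑ lookup (Obs G S)
  closedNbhd⊑Obs S = iter-inflationary forceStep-inflationary n (closedNbhd G S)

  Obs-closed : ∀ S → Closed (Obs G S)
  Obs-closed S = stable⇒closed (Obs G S)
                   (iter-stable forceStep-inflationary forceStep-monotone (closedNbhd G S))

  Obs-⊑-[]≔true : ∀ S w → lookup (Obs G S) ⊑ lookup (Obs G (S [ w ]≔ true))
  Obs-⊑-[]≔true S w = Obs-monotone S (S [ w ]≔ true) (⊑[]≔true S w)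

  Obs-[]≔true-self : ∀ S w → lookup (Obs G (S [ w ]≔ true)) w ≡ true
  Obs-[]≔true-self S w =
    closedNbhd⊑Obs (S [ w ]≔ true) w (⊑closedNbhd (S [ w ]≔ true) w (lookup∘update w S true))

  Obs-[]≔true-nbr : ∀ S w v → adj G w v ≡ true → lookup (Obs G (S [ w ]≔ true)) v ≡ true
  Obs-[]≔true-nbr S w v wv =
    closedNbhd⊑Obs (S [ w ]≔ true) v (nbr∈closedNbhd (S [ w ]≔ true) (lookup∘update w S true) wv)

  closedNbhd-gain : ∀ O O' w → lookup O ⊑ lookup O' → lookup O' w ≡ true →
                    (∀ v → adj G w v ≡ true → lookup O' v ≡ true) →
                    unobsClosedNbrs O w + ∣ O ∣ ≤ ∣ O' ∣
  closedNbhd-gain O O' w O⊑O' w∈O' N⊑O' = gain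
    where
    X : Fin n → Bool
    X v = lookup O v ∨ adj G w v

    O⊑X : lookup O ⊑ X
    O⊑X v ov rewrite ov = refl

    X⊑O' : X ⊑ lookup O'
    X⊑O' v Xv with ∨-elim Xv
    ... | inj₁ ov = O⊑O' v ov
    ... | inj₂ wv = N⊑O' v wv

    X-outside-O : ∀ v → X v ∧ not (lookup O v) ≡ adj G w v ∧ not (lookup O v)
    X-outside-O v with lookup O v
    ... | true  = sym (∧-zeroʳ (adj G w v))
    ... | false = refl

    ∣X∣≡∣O∣+unobs : countFin X ≡ ∣ O ∣ + unobsNbrs G O w
    ∣X∣≡∣O∣+unobs = trans (countFin-⊑-split O⊑X)
                          (cong₂ _+_ (sym (∣p∣≡countFin O)) (countFin-cong X-outside-O))

    gain : unobsClosedNbrs O w + ∣ O ∣ ≤ ∣ O' ∣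
    gain with lookup O w in ow
    ... | true  = begin
      unobsNbrs G O w + ∣ O ∣   ≡⟨ +-comm (unobsNbrs G O w) ∣ O ∣ ⟩
      ∣ O ∣ + unobsNbrs G O w   ≡⟨ sym ∣X∣≡∣O∣+unobs ⟩
      countFin X                ≤⟨ countFin-mono X⊑O' ⟩
      countFin (lookup O')      ≡⟨ sym (∣p∣≡countFin O') ⟩
      ∣ O' ∣                    ∎
      where open ≤-Reasoning
    ... | false = begin
      1 + (unobsNbrs G O w + ∣ O ∣) ≡⟨ cong suc (+-comm (unobsNbrs G O w) ∣ O ∣) ⟩
      1 + (∣ O ∣ + unobsNbrs G O w) ≡⟨ cong suc (sym ∣X∣≡∣O∣+unobs) ⟩
      1 + countFin X                ≤⟨ countFin-strict w X⊑O' w∈O' (cong₂ _∨_ ow (irrefl G w)) ⟩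
      countFin (lookup O')          ≡⟨ sym (∣p∣≡countFin O') ⟩
      ∣ O' ∣                        ∎
      where open ≤-Reasoning

  newlyObserved-isFort : ∀ O O' x → lookup O ⊑ lookup O' → Closed O → Closed O' →
                         (∀ w → unobsClosedNbrs O w ≤ 2) →
                         lookup O x ≡ false → lookup O' x ≡ true → IsFort G (O' ─ O)
  newlyObserved-isFort O O' x O⊑O' closed closed' sparse ox ox' = nonempty , no-lone-neighbour
    where
    lookup-D : ∀ v → lookup (O' ─ O) v ≡ lookup O' v ∧ not (lookup O v)
    lookup-D = lookup-─ O' O

    nonempty : O' ─ O ≢ ⊥
    nonempty D≡⊥ = contradiction
      (trans (sym (trans (lookup-D x) (cong₂ (λ a b → a ∧ not b) ox' ox)))
             (trans (cong (λ p → lookup p x) D≡⊥) (lookup-replicate x false)))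
      λ ()

    no-lone-neighbour : ∀ v → lookup (O' ─ O) v ≡ false →
                        countFin (λ u → adj G v u ∧ lookup (O' ─ O) u) ≢ 1
    no-lone-neighbour v v∉D one with lookup O' v in ov' | lookup O v in ov
    ... | true  | false = contradiction
      (trans (sym v∉D) (trans (lookup-D v) (cong₂ (λ a b → a ∧ not b) ov' ov))) λ ()
    ... | true  | true  =
      closed' v ov' (≤-antisym (s≤s⁻¹ at-most-two) (n≢0⇒n>0 (closed v ov ∘ trans split ∘ cong suc)))
      where
      split : unobsNbrs G O v ≡ suc (unobsNbrs G O' v)
      split = trans (unobsNbrs-split O O' v O⊑O')
                    (trans (cong (unobsNbrs G O' v +_) one) (+-comm _ 1))
      at-most-two : suc (unobsNbrs G O' v) ≤ 2
      at-most-two = subst (_≤ 2) (trans (unobsClosedNbrs-observed O ov) split) (sparse v)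
    ... | false | _
      with countFin-witness (λ u → adj G v u ∧ lookup (O' ─ O) u) (≤-reflexive (sym one))
    ...   | d , vd∧d∈D = closed' d od' (≤-antisym unobs'≤1 (unobsNbrs-pos O' dv ov'))
      where
      dv : adj G d v ≡ true
      dv = trans (Graph.sym G d v) (∧-conicalˡ _ _ vd∧d∈D)
      d∈D : lookup O' d ∧ not (lookup O d) ≡ true
      d∈D = trans (sym (lookup-D d)) (∧-conicalʳ (adj G v d) _ vd∧d∈D)
      od' : lookup O' d ≡ true
      od' = ∧-conicalˡ _ _ d∈D
      od : lookup O d ≡ false
      od = not-true (∧-conicalʳ (lookup O' d) _ d∈D)
      unobs'≤1 : unobsNbrs G O' d ≤ 1
      unobs'≤1 = ≤-trans (unobsNbrs-antitone O O' d O⊑O')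
                   (s≤s⁻¹ (subst (_≤ 2) (unobsClosedNbrs-unobserved O od) (sparse d)))

  Obs-gain-three : (∀ F → IsFort G F → 3 ≤ ∣ F ∣) → ∀ S x → lookup (Obs G S) x ≡ false →
                   ∃ λ w → 3 + ∣ Obs G S ∣ ≤ ∣ Obs G (S [ w ]≔ true) ∣
  Obs-gain-three forts S x ox with any? (λ w → 3 ≤? unobsClosedNbrs (Obs G S) w)
  ... | yes (w , 3≤) = w , ≤-trans (+-monoˡ-≤ ∣ Obs G S ∣ 3≤)
    (closedNbhd-gain (Obs G S) (Obs G (S [ w ]≔ true)) w
      (Obs-⊑-[]≔true S w) (Obs-[]≔true-self S w) (Obs-[]≔true-nbr S w))
  ... | no none = x , (begin
    3 + ∣ O ∣          ≤⟨ +-monoˡ-≤ ∣ O ∣ (forts (O' ─ O) newly-isFort) ⟩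
    ∣ O' ─ O ∣ + ∣ O ∣ ≡⟨ +-comm ∣ O' ─ O ∣ ∣ O ∣ ⟩
    ∣ O ∣ + ∣ O' ─ O ∣ ≡⟨ sym (∣q∣≡∣p∣+∣q─p∣ O O' (Obs-⊑-[]≔true S x)) ⟩
    ∣ O' ∣             ∎)
    where
    open ≤-Reasoning
    O  = Obs G S
    O' = Obs G (S [ x ]≔ true)
    sparse : ∀ w → unobsClosedNbrs O w ≤ 2
    sparse w = s≤s⁻¹ (≰⇒> (λ 3≤ → none (w , 3≤)))
    newly-isFort : IsFort G (O' ─ O)
    newly-isFort = newlyObserved-isFort O O' x (Obs-⊑-[]≔true S x)
      (Obs-closed S) (Obs-closed (S [ x ]≔ true)) sparse ox (Obs-[]≔true-self S x)

  private
    obsSizes : ℕ → List ℕ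
    obsSizes k = map (λ S → ∣ Obs G S ∣) (filterᵇ (λ S → ∣ S ∣ ≡ᵇ k) (allSubsets n))

  maxObs-upper : ∀ S → ∣ Obs G S ∣ ≤ maxObs G ∣ S ∣
  maxObs-upper S = foldr-preservesᵒ ⊔-preserves-≥ 0 (obsSizes ∣ S ∣) (inj₂ (Any.map ≤-reflexive S∈))
    where
    ⊔-preserves-≥ : ∀ a b → ∣ Obs G S ∣ ≤ a ⊎ ∣ Obs G S ∣ ≤ b → ∣ Obs G S ∣ ≤ a ⊔ b
    ⊔-preserves-≥ a b = [ m≤n⇒m≤n⊔o b , m≤n⇒m≤o⊔n a ]
    S∈ : ∣ Obs G S ∣ ∈ obsSizes ∣ S ∣
    S∈ = ∈-map⁺ _ (∈-filter⁺ (T? ∘ (λ T → ∣ T ∣ ≡ᵇ ∣ S ∣))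
                             (allSubsets-complete S) (≡⇒≡ᵇ ∣ S ∣ ∣ S ∣ refl))

  maxObs-attained : ∀ {k} → k ≤ n → ∃ λ S → ∣ S ∣ ≡ k × maxObs G k ≤ ∣ Obs G S ∣
  maxObs-attained {k} k≤n with foldr-selective ⊔-sel 0 (obsSizes k)
  ... | inj₁ max≡0 = let S , ∣S∣≡k = subsetOfSize k≤n in S , ∣S∣≡k , ≤-trans (≤-reflexive max≡0) z≤n
  ... | inj₂ max∈  with ∈-map⁻ _ max∈
  ...   | S , S∈ , max≡ =
    S , ≡ᵇ⇒≡ _ _ (proj₂ (∈-filter⁻ (T? ∘ (λ T → ∣ T ∣ ≡ᵇ k)) {xs = allSubsets n} S∈))
      , ≤-reflexive max≡

  maxObs-step : (∀ F → IsFort G F → 3 ≤ ∣ F ∣) → ∀ {k} → k ≤ n →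
                (∀ S → ∣ S ∣ ≡ k → ¬ IsPDS G S) → 3 + maxObs G k ≤ maxObs G (suc k)
  maxObs-step forts {k} k≤n no-pds with maxObs-attained k≤n
  ... | S , ∣S∣≡k , max≤ with p≢⊤⇒∃-outside (no-pds S ∣S∣≡k)
  ... | x , ox with Obs-gain-three forts S x ox
  ... | w , gain = begin
    3 + maxObs G k              ≤⟨ +-monoʳ-≤ 3 max≤ ⟩
    3 + ∣ Obs G S ∣             ≤⟨ gain ⟩
    ∣ Obs G (S [ w ]≔ true) ∣   ≤⟨ maxObs-upper (S [ w ]≔ true) ⟩
    maxObs G ∣ S [ w ]≔ true ∣  ≡⟨ cong (maxObs G) (trans (∣[]≔true∣ S w∉S) (cong suc ∣S∣≡k)) ⟩
    maxObs G (suc k)            ∎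
    where
    open ≤-Reasoning
    w∉S : lookup S w ≡ false
    w∉S with lookup S w in sw
    ... | false = refl
    ... | true  = contradiction (subst (λ T → 3 + ∣ Obs G S ∣ ≤ ∣ Obs G T ∣) (∈⇒[]≔true≡ S sw) gain)
                                (λ 3+m≤m → n≮n _ (≤-trans (s≤s (m≤n+m _ 2)) 3+m≤m))

lemma3p6 : (n : ℕ) (G : Graph (suc n))
           → (∀ F → IsFort G F → 3 ≤ ∣ F ∣)
           → (γ : ℕ) → IsPowerDomNumber G γ
           → (i : ℕ) → 1 ≤ i → i ≤ γ
           → 3 + maxObs G (pred i) ≤ maxObs G i
lemma3p6 n G forts γ ((S₀ , ∣S₀∣≡γ , _) , γ-minimal) (suc j) _ j<γ =
  maxObs-step G forts (≤-trans (n≤1+n j) (≤-trans j<γ γ≤1+n)) no-pds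
  where
  γ≤1+n : γ ≤ suc n
  γ≤1+n = subst (_≤ suc n) ∣S₀∣≡γ (∣p∣≤n S₀)
  no-pds : ∀ S → ∣ S ∣ ≡ j → ¬ IsPDS G S
  no-pds S ∣S∣≡j pds = n≮n j (≤-trans j<γ (subst (γ ≤_) ∣S∣≡j (γ-minimal S pds)))
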